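{- Let $N=(B,L,p^{\min}_l,p^{\max}_l,p^{\max}_g,c)$ be a DC network and let $\mathcal F(N)$ denote its set of feasible solutions. Then $$\mathrm{MSF}(N)\ \ge\ \sum_{a\in B} p^{\min}_l(a)\quad\Longleftrightarrow\quad \mathcal F(N)\neq\emptyset .$$
   Context: A DC network is a tuple $N=(B,L,p^{\min}_l,p^{\max}_l,p^{\max}_g,c)$ where $B$ is a finite set of buses; $L$ is a set of lines, each line being a triple $(\{a,b\},\kappa,s)$ with $a,b\in B$, capacity $\kappa\ge 0$ and susceptance $s\ge 0$ (any two lines on the same pair $\{a,b\}$ have the same capacity and susceptance); $p^{\min}_l,p^{\max}_l:B\to\mathbb R_{\ge0}$ are the minimum and maximum demand; $p^{\max}_g:B\to\mathbb R_{\ge 0}$ is the maximum generation; $c:B\to\mathbb R_{\ge0}$ are generation costs. The directed lines are $\vec L=\{(a,b,\kappa,s),(b,a,\kappa,s): (\{a,b\},\kappa,s)\in L\}$. A tuple $(S,\theta,p_g,p_l)$ with $S\subseteq L$ (the switched-off lines, with directed version $\vec S$), phase angles $\theta:B\to\mathbb R$, generation $p_g:B\to\mathbb R_{\ge0}$ and load $p_l:B\to\mathbb R_{\ge0}$ defines flows $f(a,b,\kappa,s)=s(\theta(b)-\theta(a))$ on each $(a,b,\kappa,s)\in\vec L\setminus\vec S$. It is a feasible solution if: $|f(e)|\le\kappa$ for every $e=(a,b,\kappa,s)\in\vec L\setminus\vec S$; $p^{\min}_l(a)\le p_l(a)\le p^{\max}_l(a)$ and $0\le p_g(a)\le p^{\max}_g(a)$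 for all $a\in B$; and for every $a\in B$, $\sum f(a,b,\kappa,s)=p_g(a)-p_l(a)$, the sum over all $(a,b,\kappa,s)\in\vec L\setminus\vec S$ leaving $a$. $\mathcal F(N)$ is the set of feasible solutions, and the maximum switching flow is $\mathrm{MSF}(N)=\max_{(S,\theta,p_g,p_l)\in\mathcal F(N)}\sum_{a\in B}p_l(a)$.
   Formalization: The network data (capacities, susceptances, demand bounds, maximum generation, costs) and the solution values (phase angles, generation, load) are rational rather than real. -}

module Defs where

open import Data.Nat using (ℕ; zero; suc)
open import Data.Fin using (Fin; zero; suc; _≟_)
open import Data.Bool using (Bool; true; false)
open import Data.Rational using (ℚ; 0ℚ; _+_; _-_; _*_; _≤_; ∣_∣)
open import Data.Product using (Σ; _×_; _,_; ∃)
open import Data.Sum using (_⊎_)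
open import Relation.Nullary using (yes; no)
open import Relation.Binary.PropositionalEquality using (_≡_)

Σ[_] : (k : ℕ) → (Fin k → ℚ) → ℚ
Σ[ zero ] f = 0ℚ
Σ[ suc k ] f = f zero + Σ[ k ] (λ i → f (suc i))

-- A DC network with buses Fin n and lines indexed by Fin m.
-- Line i is ({end₁ i, end₂ i}, cap i, sus i).
record Network (n m : ℕ) : Set where
  field
    end₁ end₂ : Fin m → Fin n
    cap sus   : Fin m → ℚ
    cap≥0     : ∀ i → 0ℚ ≤ cap i
    sus≥0     : ∀ i → 0ℚ ≤ sus i
    plmin plmax pgmax cost : Fin n → ℚ
    plmin≥0   : ∀ a → 0ℚ ≤ plmin a
    plmax≥0   : ∀ a → 0ℚ ≤ plmax a
    pgmax≥0   : ∀ a → 0ℚ ≤ pgmax a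
    cost≥0    : ∀ a → 0ℚ ≤ cost a

  SamePair : Fin m → Fin m → Set
  SamePair i j = (end₁ i ≡ end₁ j × end₂ i ≡ end₂ j)
               ⊎ (end₁ i ≡ end₂ j × end₂ i ≡ end₁ j)

  field
    samePair-consistent : ∀ i j → SamePair i j → cap i ≡ cap j × sus i ≡ sus j
    -- L is a set: distinct indices give distinct lines
    lines-distinct : ∀ i j → SamePair i j → cap i ≡ cap j → sus i ≡ sus j → i ≡ j

-- Candidate solution (S, θ, p_g, p_l); S i ≡ true means line i is switched off.
record Solution (n m : ℕ) : Set where
  field
    S   : Fin m → Bool
    θ   : Fin n → ℚ
    pg  : Fin n → ℚ
    pl  : Fin n → ℚ

module _ {n m : ℕ} (N : Network n m) (x : Solution n m) where
  open Network N
  open Solution x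

  -- flow on directed line (end₁ i → end₂ i); the reverse direction carries its negation
  flow : Fin m → ℚ
  flow i = sus i * (θ (end₂ i) - θ (end₁ i))

  -- contribution of line i to the net outflow at bus a
  -- (sum over directed, switched-on lines leaving a; a self-loop has flow 0)
  outflow : Fin n → Fin m → ℚ
  outflow a i with S i
  ... | true = 0ℚ
  ... | false with end₁ i ≟ a
  ...   | yes _ = flow i
  ...   | no _ with end₂ i ≟ a
  ...     | yes _ = sus i * (θ (end₁ i) - θ (end₂ i))
  ...     | no _ = 0ℚ

  record Feasible : Set where
    field
      capacity   : ∀ i → S i ≡ false → ∣ flow i ∣ ≤ cap i
      load-lo    : ∀ a → plmin a ≤ pl a
      load-hi    : ∀ a → pl a ≤ plmax a
      gen-lo     : ∀ a → 0ℚ ≤ pg a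
      gen-hi     : ∀ a → pg a ≤ pgmax a
      balance    : ∀ a → Σ[ m ] (outflow a) ≡ pg a - pl a

  totalLoad : ℚ
  totalLoad = Σ[ n ] pl

FeasibleNonempty : {n m : ℕ} → Network n m → Set
FeasibleNonempty {n} {m} N = ∃ λ (x : Solution n m) → Feasible N x

-- MSF(N) ≥ v : the maximum of the total load over F(N) is at least v,
-- i.e. some feasible solution attains total load ≥ v (false when F(N) = ∅).
MSF≥ : {n m : ℕ} → Network n m → ℚ → Set
MSF≥ {n} {m} N v = ∃ λ (x : Solution n m) → Feasible N x × v ≤ totalLoad N x

{-# OPTIONS --safe #-}
module Submission where

open import Defs
open import Data.Nat using (ℕ; zero; suc)
open import Data.Fin using (Fin; zero; suc)
open import Data.Product using (_,_)
open import Data.Rational using (ℚ; _≤_)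
open import Data.Rational.Properties using (≤-refl; +-mono-≤)
open import Function.Bundles using (_⇔_; mk⇔)

Σ-mono-≤ : (k : ℕ) {f g : Fin k → ℚ} → (∀ i → f i ≤ g i) → Σ[ k ] f ≤ Σ[ k ] g
Σ-mono-≤ zero    f≤g = ≤-refl
Σ-mono-≤ (suc k) f≤g = +-mono-≤ (f≤g zero) (Σ-mono-≤ k (λ i → f≤g (suc i)))

Σplmin≤totalLoad : {n m : ℕ} (N : Network n m) {x : Solution n m} →
                   Feasible N x → Σ[ n ] (Network.plmin N) ≤ totalLoad N x
Σplmin≤totalLoad {n} N feasible = Σ-mono-≤ n (Feasible.load-lo feasible)

lemma1 : (n m : ℕ) (N : Network n m) →
             MSF≥ N (Σ[ n ] (Network.plmin N)) ⇔ FeasibleNonempty N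
lemma1 n m N = mk⇔
  (λ { (x , feasible , _) → x , feasible })
  (λ { (x , feasible) → x , feasible , Σplmin≤totalLoad N feasible })
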